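{- Let $x$ and $y$ be two different binary words with $\pi_x = \pi_y$. Then $y = \overline{x}$.
   Context: For a binary word $w$ over $\{0,1\}$, $ones(w)$ denotes the number of $1$'s in $w$. Two binary words of equal length are abelian equivalent if they have the same number of $1$'s. An abelian border of a binary word $w$ is a proper prefix of $w$ (a prefix different from $w$, possibly empty) that is abelian equivalent to the proper suffix of $w$ of the same length. For a binary word $x$ of length $n$, the abelian border array $\pi_x$ is the array of length $n$ with $\pi_x[i]$ ($1\le i\le n$) equal to the length of the longest abelian border of the prefix $x[1\cdots i]$. The complement $\overline{x}$ of a binary word $x$ is the word of the same length with $\overline{x}[i]=1$ if $x[i]=0$ and $\overline{x}[i]=0$ otherwise. -}

module Defs where

open import Data.Bool using (Bool; true; false; not; if_then_else_)
open import Data.Nat using (ℕ; zero; suc; _+_; _∸_; _⊔_; _≡ᵇ_)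
open import Data.List using (List; []; _∷_; length; take; drop; map; foldr; upTo)

-- Binary words over {0,1}: true = 1, false = 0.
Word : Set
Word = List Bool

ones : Word → ℕ
ones [] = 0
ones (true ∷ w) = suc (ones w)
ones (false ∷ w) = ones w

prefix : ℕ → Word → Word
prefix k w = take k w

suffix : ℕ → Word → Word
suffix k w = drop (length w ∸ k) w

isAbBorderᵇ : Word → ℕ → Bool
isAbBorderᵇ w k = ones (prefix k w) ≡ᵇ ones (suffix k w)

-- The empty border (k = 0) always qualifies; for w = [] the value is 0.
longestAbBorder : Word → ℕ
longestAbBorder w =
  foldr (λ k acc → if isAbBorderᵇ w k then k ⊔ acc else acc) 0 (upTo (length w))

-- abelian border array: π_x[i] = longestAbBorder (x[1..i]) for i = 1..n
abBorderArray : Word → List ℕ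
abBorderArray x = map (λ i → longestAbBorder (take (suc i) x)) (upTo (length x))

complement : Word → Word
complement = map not

-- π determines x up to complementation, by induction on |x| from the right.
-- Complementing a word preserves each of its abelian borders, hence π.  And for
-- a nonempty word u the values π(u0) and π(u1) differ: one of u0, u1 ends with
-- the first letter of u and so has a border of length 1, making the common value
-- m positive; but a border of length j + 1 of u a means
-- ones(u[1..j+1]) = ones(last j letters of u) + ones(a), which cannot hold for
-- both letters a.
module Submission where

open import Defs
open import Relation.Binary.PropositionalEquality
  using (_≡_; _≢_; refl; sym; trans; cong; cong₂; subst; module ≡-Reasoning)
open import Data.Bool using (Bool; true; false; not; if_then_else_; T)
open import Data.Bool.Properties using (T-≡; ⇔→≡; not-¬; not-involutive)
open import Data.Nat using (ℕ; zero; suc; _+_; _∸_; _⊔_; _⊓_; _≡ᵇ_; _≤_; _<_; z≤n; s≤s; s≤s⁻¹)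
open import Data.Nat.Properties
  using ( ≡ᵇ⇒≡; ≡⇒≡ᵇ; +-cancelˡ-≡; +-cancelʳ-≡; +-comm; ≤-refl; ≤-trans; ≤-reflexive
        ; m≤m⊔n; m≤n⊔m; ⊔-sel; m∸n≤m; m+n∸n≡m; m⊓n+n∸m≡n; suc-injective)
open import Data.List using (List; []; _∷_; _++_; _∷ʳ_; length; take; drop; map; foldr; upTo; initLast; _∷ʳ′_)
open import Data.List.Properties
  using ( length-++; length-map; length-take; length-drop; take-map; drop-map; drop-all; take-all
        ; upTo-∷ʳ; map-++; map-cong-local; ∷ʳ-injective; length-upTo)
open import Data.List.Membership.Propositional using (_∈_)
open import Data.List.Membership.Propositional.Properties using (∈-upTo⁺; ∈-upTo⁻)
open import Data.List.Relation.Unary.Any using (here; there)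
import Data.List.Relation.Unary.All as All
open import Data.Product using (_×_; _,_; proj₁; proj₂)
open import Data.Sum using (_⊎_; inj₁; inj₂; [_,_]′)
open import Data.Empty using (⊥-elim)
open import Function.Base using (id)
open import Function.Bundles using (Equivalence; mk⇔)

open Equivalence using (to; from)

bool-dichotomy : ∀ a b → b ≡ a ⊎ b ≡ not a
bool-dichotomy false false = inj₁ refl
bool-dichotomy false true  = inj₂ refl
bool-dichotomy true  false = inj₂ refl
bool-dichotomy true  true  = inj₁ refl

≡ᵇ-cancel : ∀ a b c d → a + b ≡ c + d → (a ≡ᵇ c) ≡ (b ≡ᵇ d)
≡ᵇ-cancel a b c d e = ⇔→≡ (mk⇔ a≡c⇒b≡d b≡d⇒a≡c)
  where
  a≡c⇒b≡d : (a ≡ᵇ c) ≡ true → (b ≡ᵇ d) ≡ true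
  a≡c⇒b≡d p = to T-≡ (≡⇒≡ᵇ b d (+-cancelˡ-≡ a b d
    (trans e (cong (_+ d) (sym (≡ᵇ⇒≡ a c (from T-≡ p)))))))
  b≡d⇒a≡c : (b ≡ᵇ d) ≡ true → (a ≡ᵇ c) ≡ true
  b≡d⇒a≡c p = to T-≡ (≡⇒≡ᵇ a c (+-cancelʳ-≡ b a c
    (trans e (cong (c +_) (sym (≡ᵇ⇒≡ b d (from T-≡ p)))))))

maxWhere : (ℕ → Bool) → List ℕ → ℕ
maxWhere p = foldr (λ k acc → if p k then k ⊔ acc else acc) 0

maxWhere-cong : ∀ {p q} → (∀ k → p k ≡ q k) → ∀ l → maxWhere p l ≡ maxWhere q l
maxWhere-cong p≡q []      = refl
maxWhere-cong p≡q (k ∷ l) rewrite p≡q k | maxWhere-cong p≡q l = refl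

≤-maxWhere : ∀ p {l k} → k ∈ l → T (p k) → k ≤ maxWhere p l
≤-maxWhere p {k ∷ l} (here refl) pk with p k
... | true = m≤m⊔n k (maxWhere p l)
≤-maxWhere p {x ∷ l} (there k∈l) pk with p x
... | true  = ≤-trans (≤-maxWhere p k∈l pk) (m≤n⊔m x (maxWhere p l))
... | false = ≤-maxWhere p k∈l pk

maxWhere-zero-or-attained : ∀ p l → maxWhere p l ≡ 0 ⊎ (maxWhere p l ∈ l × T (p (maxWhere p l)))
maxWhere-zero-or-attained p [] = inj₁ refl
maxWhere-zero-or-attained p (x ∷ l) with p x in px | maxWhere-zero-or-attained p l
... | false | inj₁ z           = inj₁ z
... | false | inj₂ (m∈l , pm) = inj₂ (there m∈l , pm)
... | true  | rest with ⊔-sel x (maxWhere p l)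
...   | inj₁ x⊔m≡x rewrite x⊔m≡x = inj₂ (here refl , from T-≡ px)
...   | inj₂ x⊔m≡m rewrite x⊔m≡m with rest
...     | inj₁ z           = inj₁ z
...     | inj₂ (m∈l , pm) = inj₂ (there m∈l , pm)

abBorder⇒≤longestAbBorder : ∀ w {k} → k < length w → T (isAbBorderᵇ w k) → k ≤ longestAbBorder w
abBorder⇒≤longestAbBorder w k<∣w∣ = ≤-maxWhere (isAbBorderᵇ w) (∈-upTo⁺ k<∣w∣)

longestAbBorder-isAbBorder : ∀ w → 1 ≤ longestAbBorder w →
  longestAbBorder w < length w × T (isAbBorderᵇ w (longestAbBorder w))
longestAbBorder-isAbBorder w 1≤m with maxWhere-zero-or-attained (isAbBorderᵇ w) (upTo (length w))
... | inj₁ m≡0 with () ← subst (1 ≤_) m≡0 1≤m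
... | inj₂ (m∈ , border) = ∈-upTo⁻ m∈ , border

ones-complement : ∀ v → ones (complement v) + ones v ≡ length v
ones-complement []          = refl
ones-complement (true ∷ v)  = trans (+-comm (ones (complement v)) (suc (ones v)))
                                (cong suc (trans (+-comm (ones v) _) (ones-complement v)))
ones-complement (false ∷ v) = cong suc (ones-complement v)

length-prefix≡length-suffix : ∀ k w → length (prefix k w) ≡ length (suffix k w)
length-prefix≡length-suffix k w = begin
  length (take k w)          ≡⟨ length-take k w ⟩
  k ⊓ n                      ≡⟨ m+n∸n≡m (k ⊓ n) (n ∸ k) ⟨
  k ⊓ n + (n ∸ k) ∸ (n ∸ k)  ≡⟨ cong (_∸ (n ∸ k)) (m⊓n+n∸m≡n k n) ⟩
  n ∸ (n ∸ k)                ≡⟨ length-drop (n ∸ k) w ⟨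
  length (drop (n ∸ k) w)    ∎
  where
  open ≡-Reasoning
  n : ℕ
  n = length w

isAbBorderᵇ-complement : ∀ w k → isAbBorderᵇ (complement w) k ≡ isAbBorderᵇ w k
isAbBorderᵇ-complement w k
  rewrite length-map not w | take-map {f = not} k w | drop-map {f = not} (length w ∸ k) w
  = ≡ᵇ-cancel (ones (complement p)) (ones p) (ones (complement s)) (ones s) (begin
      ones (complement p) + ones p  ≡⟨ ones-complement p ⟩
      length p                      ≡⟨ length-prefix≡length-suffix k w ⟩
      length s                      ≡⟨ ones-complement s ⟨
      ones (complement s) + ones s  ∎)
  where
  open ≡-Reasoning
  p s : Word
  p = prefix k w
  s = suffix k w

longestAbBorder-complement : ∀ w → longestAbBorder (complement w) ≡ longestAbBorder w
longestAbBorder-complement w = trans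
  (cong (λ n → maxWhere (isAbBorderᵇ (complement w)) (upTo n)) (length-map not w))
  (maxWhere-cong (isAbBorderᵇ-complement w) (upTo (length w)))

ones-++ : ∀ v w → ones (v ++ w) ≡ ones v + ones w
ones-++ []          w = refl
ones-++ (true ∷ v)  w = cong suc (ones-++ v w)
ones-++ (false ∷ v) w = ones-++ v w

ones-[-]-injective : ∀ {a b} → ones (a ∷ []) ≡ ones (b ∷ []) → a ≡ b
ones-[-]-injective {false} {false} _ = refl
ones-[-]-injective {true}  {true}  _ = refl

length-∷ʳ : ∀ {A : Set} (u : List A) a → length (u ∷ʳ a) ≡ suc (length u)
length-∷ʳ u a = trans (length-++ u) (+-comm (length u) 1)

take-∷ʳ : ∀ {A : Set} k (u : List A) a → k ≤ length u → take k (u ∷ʳ a) ≡ take k u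
take-∷ʳ zero    u       a _         = refl
take-∷ʳ (suc k) (x ∷ u) a (s≤s k≤n) = cong (x ∷_) (take-∷ʳ k u a k≤n)

drop-∷ʳ : ∀ {A : Set} k (u : List A) a → k ≤ length u → drop k (u ∷ʳ a) ≡ drop k u ∷ʳ a
drop-∷ʳ zero    u       a _         = refl
drop-∷ʳ (suc k) (x ∷ u) a (s≤s k≤n) = drop-∷ʳ k u a k≤n

isAbBorderᵇ-∷ʳ : ∀ u a j → suc j ≤ length u →
  isAbBorderᵇ (u ∷ʳ a) (suc j) ≡ (ones (prefix (suc j) u) ≡ᵇ ones (suffix j u) + ones (a ∷ []))
isAbBorderᵇ-∷ʳ u a j j<∣u∣
  rewrite length-∷ʳ u a | take-∷ʳ (suc j) u a j<∣u∣ | drop-∷ʳ (length u ∸ j) u a (m∸n≤m (length u) j)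
        | ones-++ (suffix j u) (a ∷ [])
  = refl

abBorder-∷ʳ-letter : ∀ u a b {k} → 1 ≤ k → k < length (u ∷ʳ a) →
  T (isAbBorderᵇ (u ∷ʳ a) k) → T (isAbBorderᵇ (u ∷ʳ b) k) → a ≡ b
abBorder-∷ʳ-letter u a b {suc j} _ k<∣ua∣ border-a border-b =
  ones-[-]-injective (+-cancelˡ-≡ (ones (suffix j u)) _ _ (trans (sym (balance a border-a)) (balance b border-b)))
  where
  j<∣u∣ : suc j ≤ length u
  j<∣u∣ = s≤s⁻¹ (subst (suc j <_) (length-∷ʳ u a) k<∣ua∣)
  balance : ∀ c → T (isAbBorderᵇ (u ∷ʳ c) (suc j)) →
    ones (prefix (suc j) u) ≡ ones (suffix j u) + ones (c ∷ [])
  balance c border = ≡ᵇ⇒≡ _ _ (subst T (isAbBorderᵇ-∷ʳ u c j j<∣u∣) border)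

1≤longestAbBorder-first≡last : ∀ c u → 1 ≤ longestAbBorder ((c ∷ u) ∷ʳ c)
1≤longestAbBorder-first≡last c u =
  abBorder⇒≤longestAbBorder ((c ∷ u) ∷ʳ c) (subst (1 <_) (sym (length-∷ʳ (c ∷ u) c)) (s≤s (s≤s z≤n))) border₁
  where
  border₁ : T (isAbBorderᵇ ((c ∷ u) ∷ʳ c) 1)
  border₁ rewrite isAbBorderᵇ-∷ʳ (c ∷ u) c 0 (s≤s z≤n) | drop-all (length (c ∷ u)) (c ∷ u) ≤-refl
    = ≡⇒≡ᵇ (ones (c ∷ [])) _ refl

longestAbBorder-∷ʳ-positive : ∀ c u a →
  1 ≤ longestAbBorder ((c ∷ u) ∷ʳ a) ⊎ 1 ≤ longestAbBorder ((c ∷ u) ∷ʳ not a)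
longestAbBorder-∷ʳ-positive c u a with bool-dichotomy a c
... | inj₁ refl = inj₁ (1≤longestAbBorder-first≡last a u)
... | inj₂ refl = inj₂ (1≤longestAbBorder-first≡last (not a) u)

longestAbBorder-∷ʳ-not : ∀ c u a → longestAbBorder ((c ∷ u) ∷ʳ a) ≢ longestAbBorder ((c ∷ u) ∷ʳ not a)
longestAbBorder-∷ʳ-not c u a e =
  not-¬ refl (abBorder-∷ʳ-letter w a (not a) 1≤m (proj₁ longest-a) (proj₂ longest-a) border-not-a)
  where
  w : Word
  w = c ∷ u
  1≤m : 1 ≤ longestAbBorder (w ∷ʳ a)
  1≤m = [ id , subst (1 ≤_) (sym e) ]′ (longestAbBorder-∷ʳ-positive c u a)
  longest-a : longestAbBorder (w ∷ʳ a) < length (w ∷ʳ a) × T (isAbBorderᵇ (w ∷ʳ a) (longestAbBorder (w ∷ʳ a)))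
  longest-a = longestAbBorder-isAbBorder (w ∷ʳ a) 1≤m
  border-not-a : T (isAbBorderᵇ (w ∷ʳ not a) (longestAbBorder (w ∷ʳ a)))
  border-not-a = subst (λ k → T (isAbBorderᵇ (w ∷ʳ not a) k)) (sym e)
    (proj₂ (longestAbBorder-isAbBorder (w ∷ʳ not a) (subst (1 ≤_) e 1≤m)))

longestAbBorder-∷ʳ-injective : ∀ c u a b →
  longestAbBorder ((c ∷ u) ∷ʳ a) ≡ longestAbBorder ((c ∷ u) ∷ʳ b) → a ≡ b
longestAbBorder-∷ʳ-injective c u a b e with bool-dichotomy a b
... | inj₁ b≡a = sym b≡a
... | inj₂ refl = ⊥-elim (longestAbBorder-∷ʳ-not c u a e)

complement-∷ʳ : ∀ w a → complement (w ∷ʳ a) ≡ complement w ∷ʳ not a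
complement-∷ʳ w a = map-++ not w (a ∷ [])

length-abBorderArray : ∀ x → length (abBorderArray x) ≡ length x
length-abBorderArray x = trans (length-map _ (upTo (length x))) (length-upTo (length x))

abBorderArray-≡⇒length-≡ : ∀ x y → abBorderArray x ≡ abBorderArray y → length y ≡ length x
abBorderArray-≡⇒length-≡ x y πx≡πy = begin
  length y                 ≡⟨ length-abBorderArray y ⟨
  length (abBorderArray y) ≡⟨ cong length πx≡πy ⟨
  length (abBorderArray x) ≡⟨ length-abBorderArray x ⟩
  length x                 ∎
  where open ≡-Reasoning

abBorderArray-∷ʳ : ∀ w a → abBorderArray (w ∷ʳ a) ≡ abBorderArray w ∷ʳ longestAbBorder (w ∷ʳ a)
abBorderArray-∷ʳ w a = begin
  map π (upTo (length (w ∷ʳ a)))            ≡⟨ cong (map π) (trans (cong upTo (length-∷ʳ w a)) (sym (upTo-∷ʳ n))) ⟩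
  map π (upTo n ∷ʳ n)                       ≡⟨ map-++ π (upTo n) (n ∷ []) ⟩
  map π (upTo n) ∷ʳ π n                     ≡⟨ cong₂ _∷ʳ_ earlier-prefixes whole-word ⟩
  abBorderArray w ∷ʳ longestAbBorder (w ∷ʳ a) ∎
  where
  open ≡-Reasoning
  n : ℕ
  n = length w
  π : ℕ → ℕ
  π i = longestAbBorder (take (suc i) (w ∷ʳ a))
  earlier-prefixes : map π (upTo n) ≡ abBorderArray w
  earlier-prefixes = map-cong-local (All.tabulate λ i∈ → cong longestAbBorder (take-∷ʳ _ w a (∈-upTo⁻ i∈)))
  whole-word : π n ≡ longestAbBorder (w ∷ʳ a)
  whole-word = cong longestAbBorder (take-all (suc n) (w ∷ʳ a) (≤-reflexive (length-∷ʳ w a)))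

EqualOrComplement : Word → Word → Set
EqualOrComplement x y = x ≡ y ⊎ y ≡ complement x

equalOrComplement-[-] : ∀ a b → EqualOrComplement (a ∷ []) (b ∷ [])
equalOrComplement-[-] a b with bool-dichotomy a b
... | inj₁ refl = inj₁ refl
... | inj₂ refl = inj₂ refl

equalOrComplement-∷ʳ : ∀ xs ys a b → EqualOrComplement xs ys →
  longestAbBorder (xs ∷ʳ a) ≡ longestAbBorder (ys ∷ʳ b) → EqualOrComplement (xs ∷ʳ a) (ys ∷ʳ b)
equalOrComplement-∷ʳ [] _ a b (inj₁ refl) _ = equalOrComplement-[-] a b
equalOrComplement-∷ʳ [] _ a b (inj₂ refl) _ = equalOrComplement-[-] a b
equalOrComplement-∷ʳ (c ∷ u) _ a b (inj₁ refl) e =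
  inj₁ (cong ((c ∷ u) ∷ʳ_) (longestAbBorder-∷ʳ-injective c u a b e))
equalOrComplement-∷ʳ (c ∷ u) _ a b (inj₂ refl) e = inj₂ (begin
  complement (c ∷ u) ∷ʳ b        ≡⟨ cong (complement (c ∷ u) ∷ʳ_) b≡not-a ⟩
  complement (c ∷ u) ∷ʳ not a    ≡⟨ complement-∷ʳ (c ∷ u) a ⟨
  complement ((c ∷ u) ∷ʳ a)      ∎)
  where
  open ≡-Reasoning
  not-b-matches : longestAbBorder ((c ∷ u) ∷ʳ a) ≡ longestAbBorder ((c ∷ u) ∷ʳ not b)
  not-b-matches = begin
    longestAbBorder ((c ∷ u) ∷ʳ a)                   ≡⟨ e ⟩
    longestAbBorder (complement (c ∷ u) ∷ʳ b)        ≡⟨ cong (λ d → longestAbBorder (complement (c ∷ u) ∷ʳ d)) (not-involutive b) ⟨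
    longestAbBorder (complement (c ∷ u) ∷ʳ not (not b)) ≡⟨ cong longestAbBorder (complement-∷ʳ (c ∷ u) (not b)) ⟨
    longestAbBorder (complement ((c ∷ u) ∷ʳ not b))  ≡⟨ longestAbBorder-complement ((c ∷ u) ∷ʳ not b) ⟩
    longestAbBorder ((c ∷ u) ∷ʳ not b)               ∎
  b≡not-a : b ≡ not a
  b≡not-a = trans (sym (not-involutive b)) (cong not (sym (longestAbBorder-∷ʳ-injective c u a (not b) not-b-matches)))

equalOrComplement-of-abBorderArray : ∀ n x y → length x ≡ n → length y ≡ n →
  abBorderArray x ≡ abBorderArray y → EqualOrComplement x y
equalOrComplement-of-abBorderArray zero [] [] _ _ _ = inj₁ refl
equalOrComplement-of-abBorderArray (suc n) x y ∣x∣ ∣y∣ πx≡πy with initLast x | initLast y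
... | [] | _ with () ← ∣x∣
... | _ ∷ʳ′ _ | [] with () ← ∣y∣
... | xs ∷ʳ′ a | ys ∷ʳ′ b =
  equalOrComplement-∷ʳ xs ys a b
    (equalOrComplement-of-abBorderArray n xs ys (shorter xs a ∣x∣) (shorter ys b ∣y∣) (proj₁ split))
    (proj₂ split)
  where
  shorter : ∀ w c → length (w ∷ʳ c) ≡ suc n → length w ≡ n
  shorter w c ∣wc∣ = suc-injective (trans (sym (length-∷ʳ w c)) ∣wc∣)
  split : abBorderArray xs ≡ abBorderArray ys × longestAbBorder (xs ∷ʳ a) ≡ longestAbBorder (ys ∷ʳ b)
  split = ∷ʳ-injective (abBorderArray xs) (abBorderArray ys)
    (trans (sym (abBorderArray-∷ʳ xs a)) (trans πx≡πy (abBorderArray-∷ʳ ys b)))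

mainTheorem2 : (x y : Word) → x ≢ y → abBorderArray x ≡ abBorderArray y →
    y ≡ complement x
mainTheorem2 x y x≢y πx≡πy
  with equalOrComplement-of-abBorderArray (length x) x y refl (abBorderArray-≡⇒length-≡ x y πx≡πy) πx≡πy
... | inj₁ x≡y  = ⊥-elim (x≢y x≡y)
... | inj₂ y≡x̄  = y≡x̄
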